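{- Let $n\ge m\ge 2$ be integers. Then: (1) $PWW(K_n)=\binom{n}{2}$; (2) $PWW(K_{1,n})=3\binom{n}{2}$; (3) $PWW(K_{m,n})=3\binom{n}{2}+3\binom{m}{2}+nm$; (4) if $G$ is a graph with exactly $r$ peripheral vertices, then $PWW(G)\ge \binom{r}{2}$, with equality if and only if $G=K_r$.
   Context: All graphs are finite, simple, undirected, connected and have at least two vertices. $d(u,v)$ denotes the shortest-path distance in $G$. The eccentricity of a vertex $v$ is $e(v)=\max_{u\in V(G)} d(u,v)$, and the diameter $\operatorname{diam}(G)$ is the maximum eccentricity. A vertex is peripheral if its eccentricity equals $\operatorname{diam}(G)$; $\operatorname{Peri}(G)$ is the set of peripheral vertices. The peripheral hyper-Wiener index is $PWW(G)=\frac12\sum_{\{u,v\}\subseteq \operatorname{Peri}(G),\,u\ne v}\big(d(u,v)+d(u,v)^2\big)$. $K_n$ is the complete graph and $K_{m,n}$ the complete bipartite graph with parts of sizes $m,n$. -}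

module Defs where

open import Data.Nat using (ℕ; zero; suc; _+_; _*_; _⊔_; _<_; _<?_; _≤_)
open import Data.Nat.DivMod using (_/_)
open import Data.Bool using (Bool; true; false; if_then_else_; _∧_; _∨_; _xor_; not)
open import Data.Fin using (Fin; toℕ)
open import Data.Fin.Properties using (_≟_)
open import Data.List using (List; foldr; map; filter; length; allFin)
open import Data.Nat.ListAction using (sum)
open import Data.Bool.ListAction using (any)
open import Data.Product using (Σ; _×_)
open import Function.Bundles using (_↔_; Inverse)
open import Relation.Nullary.Decidable using (⌊_⌋)
open import Relation.Binary.PropositionalEquality using (_≡_)
open import Data.Nat using () renaming (_≟_ to _≟ℕ_)

Graph : ℕ → Set
Graph n = Fin n → Fin n → Bool

IsSimple : ∀ {n} → Graph n → Set
IsSimple {n} G = (∀ u v → G u v ≡ G v u) × (∀ u → G u u ≡ false)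

reach : ∀ {n} → Graph n → ℕ → Fin n → Fin n → Bool
reach G zero    u v = ⌊ u ≟ v ⌋
reach {n} G (suc k) u v = reach G k u v ∨ any (λ w → reach G k u w ∧ G w v) (allFin n)

IsConnected : ∀ {n} → Graph n → Set
IsConnected {n} G = ∀ (u v : Fin n) → Σ ℕ (λ k → reach G k u v ≡ true)

least : (ℕ → Bool) → ℕ → ℕ → ℕ
least p zero    k = k
least p (suc f) k = if p k then k else least p f (suc k)

-- Shortest-path distance: least k with a walk of length ≤ k from u to v.
-- (In a connected graph on n vertices this is < n, so searching n steps suffices.)
dist : ∀ {n} → Graph n → Fin n → Fin n → ℕ
dist {n} G u v = least (λ k → reach G k u v) n 0

maxList : List ℕ → ℕ
maxList = foldr _⊔_ 0

ecc : ∀ {n} → Graph n → Fin n → ℕ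
ecc {n} G v = maxList (map (λ u → dist G u v) (allFin n))

diam : ∀ {n} → Graph n → ℕ
diam {n} G = maxList (map (ecc G) (allFin n))

isPeri : ∀ {n} → Graph n → Fin n → Bool
isPeri G v = ⌊ ecc G v ≟ℕ diam G ⌋

numPeri : ∀ {n} → Graph n → ℕ
numPeri {n} G = length (filter (λ v → ecc G v ≟ℕ diam G) (allFin n))

-- peripheral hyper-Wiener index:
-- (1/2) Σ over unordered pairs {u,v} ⊆ Peri(G), u ≠ v, of d(u,v) + d(u,v)^2.
-- Unordered pairs are enumerated as ordered pairs with toℕ u < toℕ v.
PWW : ∀ {n} → Graph n → ℕ
PWW {n} G =
  sum (map (λ u → sum (map (λ v →
    if ⌊ toℕ u <? toℕ v ⌋ ∧ isPeri G u ∧ isPeri G v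
    then dist G u v + dist G u v * dist G u v
    else 0) (allFin n))) (allFin n)) / 2

K : (n : ℕ) → Graph n
K n u v = not ⌊ u ≟ v ⌋

KB : (m n : ℕ) → Graph (m + n)
KB m n u v = ⌊ toℕ u <? m ⌋ xor ⌊ toℕ v <? m ⌋

_≅_ : ∀ {n r} → Graph n → Graph r → Set
_≅_ {n} {r} G H = Σ (Fin n ↔ Fin r) (λ f → ∀ u v → G u v ≡ H (Inverse.to f u) (Inverse.to f v))

-- Writing d for d(u,v), each unordered pair of peripheral vertices contributes
-- (d + d²)/2 = C(d+1, 2) to PWW, and C(d+1, 2) ≥ 1 because distinct vertices are at
-- distance at least 1; so PWW G ≥ C(r, 2) for r peripheral vertices. Equality forces
-- every two peripheral vertices to be adjacent. A pair realising the diameter consists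
-- of peripheral vertices, so the diameter is at most 1 and G is complete. In K_n every
-- pair has weight 1. In K_{m,n} (m, n ≥ 2) every vertex has eccentricity 2, and a pair
-- has weight 1 across the parts and C(3, 2) = 3 inside a part, which together with
-- C(m+n, 2) = C(m, 2) + C(n, 2) + mn gives (3). In K_{1,n} only the n leaves are
-- peripheral, and they are pairwise at distance 2.
module Submission where

open import Defs
open import Data.Bool using (Bool; true; false; if_then_else_; _∧_; _xor_; not; T)
open import Data.Bool.Properties using (T-∨; T-∧; T-≡; T-not-≡; ⇔→≡; xor-same)
open import Data.Fin using (Fin; toℕ; zero; suc; _↑ʳ_)
open import Data.Fin.Properties using (_≟_; toℕ<n; toℕ-injective; ↑ʳ-injective)
open import Data.List using ([]; _∷_; map; filter; length; allFin; tabulate)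
open import Data.List.Membership.Propositional using (_∈_)
open import Data.List.Membership.Propositional.Properties
  using (∈-map⁺; ∈-map⁻; ∈-allFin; foldr-selective)
open import Data.List.Properties using (map-tabulate)
open import Data.List.Relation.Unary.Any using (here; there)
open import Data.List.Relation.Unary.Any.Properties using (any⁺; any⁻; tabulate⁺; tabulate⁻)
open import Data.Nat using (ℕ; zero; suc; _+_; _*_; _≤_; _<_; z≤n; s≤s; _<?_; _/_)
open import Data.Nat using () renaming (_≟_ to _≟ℕ_)
open import Data.Nat.Combinatorics using (_C_; nC1≡n; nCk+nC[k+1]≡[n+1]C[k+1])
open import Data.Nat.DivMod using (m*n/n≡m)
import Data.Nat.ListAction as List
open import Data.Nat.Properties hiding (_≟_)
open import Algebra.Properties.Semiring.Sum +-*-semiring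
  using (sum-syntax; sum-cong-≗; ∑-distrib-+; *-distribˡ-sum; sum-replicate-zero)
open import Data.Nat.Tactic.RingSolver using (solve-∀)
open import Data.Product using (∃-syntax; _×_; _,_; proj₁; proj₂)
open import Data.Sum using (_⊎_; inj₁; inj₂; [_,_]′)
open import Function using (_∘_; id; const)
open import Function.Bundles using (Equivalence; Inverse; Injection; _⇔_; mk⇔)
open import Function.Construct.Identity using (↔-id)
open import Function.Properties.Inverse using (↔⇒↣)
open import Relation.Binary.Definitions using (tri<; tri≈; tri>)
open import Relation.Binary.PropositionalEquality
open import Relation.Nullary using (Dec; yes; no; does; ¬_; contradiction)
open import Relation.Nullary.Decidable
  using (⌊_⌋; isYes≗does; toWitness; fromWitness; fromWitnessFalse; dec-true; dec-false; does-⇔)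
open import Relation.Nullary.Decidable.Core using (T?)

suc-C-2 : ∀ n → suc n C 2 ≡ n + n C 2
suc-C-2 n = trans (sym (nCk+nC[k+1]≡[n+1]C[k+1] n 1)) (cong (_+ n C 2) (nC1≡n n))

n≤[1+n]C2 : ∀ n → n ≤ suc n C 2
n≤[1+n]C2 n = subst (n ≤_) (sym (suc-C-2 n)) (m≤m+n n (n C 2))

n+n*n≡2*[1+n]C2 : ∀ n → n + n * n ≡ 2 * (suc n C 2)
n+n*n≡2*[1+n]C2 zero    = refl
n+n*n≡2*[1+n]C2 (suc n) = begin
    suc n + suc n * suc n        ≡⟨ regroup n ⟩
    2 * suc n + (n + n * n)      ≡⟨ cong (2 * suc n +_) (n+n*n≡2*[1+n]C2 n) ⟩
    2 * suc n + 2 * (suc n C 2)  ≡⟨ *-distribˡ-+ 2 (suc n) (suc n C 2) ⟨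
    2 * (suc n + suc n C 2)      ≡⟨ cong (2 *_) (suc-C-2 (suc n)) ⟨
    2 * (suc (suc n) C 2)        ∎
  where
  open ≡-Reasoning
  regroup : ∀ n → suc n + suc n * suc n ≡ 2 * suc n + (n + n * n)
  regroup = solve-∀

+-C-2 : ∀ m n → (m + n) C 2 ≡ m C 2 + n C 2 + m * n
+-C-2 zero    n = sym (+-identityʳ (n C 2))
+-C-2 (suc m) n = begin
    suc (m + n) C 2                   ≡⟨ suc-C-2 (m + n) ⟩
    m + n + (m + n) C 2               ≡⟨ cong (m + n +_) (+-C-2 m n) ⟩
    m + n + (m C 2 + n C 2 + m * n)   ≡⟨ regroup m n (m C 2) (n C 2) ⟩
    m + m C 2 + n C 2 + (n + m * n)   ≡⟨ cong (λ x → x + n C 2 + (n + m * n)) (suc-C-2 m) ⟨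
    suc m C 2 + n C 2 + suc m * n     ∎
  where
  open ≡-Reasoning
  regroup : ∀ m n a b → m + n + (a + b + m * n) ≡ m + a + b + (n + m * n)
  regroup = solve-∀

+-tight : ∀ {m n o p} → m ≤ o → n ≤ p → m + n ≡ o + p → m ≡ o × n ≡ p
+-tight {m} {n} {o} {p} m≤o n≤p eq = m≡o , +-cancelˡ-≡ o n p (subst (λ x → x + n ≡ o + p) m≡o eq)
  where
  m≡o : m ≡ o
  m≡o = ≤-antisym m≤o (+-cancelʳ-≤ n o m (≤-trans (+-monoʳ-≤ o n≤p) (≤-reflexive (sym eq))))

-- Sums over Fin N

sum-map-allFin : ∀ {N} (f : Fin N → ℕ) → List.sum (map f (allFin N)) ≡ ∑[ i < N ] f i
sum-map-allFin {N} f = trans (cong List.sum (map-tabulate id f)) (sum-tabulate f)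
  where
  sum-tabulate : ∀ {N} (f : Fin N → ℕ) → List.sum (tabulate f) ≡ ∑[ i < N ] f i
  sum-tabulate {zero}  f = refl
  sum-tabulate {suc N} f = cong (f zero +_) (sum-tabulate (f ∘ suc))

∑-mono-≤ : ∀ {N} {f g : Fin N → ℕ} → (∀ i → f i ≤ g i) → ∑[ i < N ] f i ≤ ∑[ i < N ] g i
∑-mono-≤ {zero}  f≤g = z≤n
∑-mono-≤ {suc N} f≤g = +-mono-≤ (f≤g zero) (∑-mono-≤ (f≤g ∘ suc))

∑≡∑⇒≗ : ∀ {N} {f g : Fin N → ℕ} → (∀ i → f i ≤ g i) →
        ∑[ i < N ] f i ≡ ∑[ i < N ] g i → ∀ i → f i ≡ g i
∑≡∑⇒≗ {suc N} f≤g eq i with +-tight (f≤g zero) (∑-mono-≤ (f≤g ∘ suc)) eq | i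
... | f0≡g0 , _      | zero  = f0≡g0
... | _     , rest≡ | suc j = ∑≡∑⇒≗ (f≤g ∘ suc) rest≡ j

if-cong : ∀ b {x y : ℕ} → (T b → x ≡ y) → (if b then x else 0) ≡ (if b then y else 0)
if-cong true  x≡y = x≡y _
if-cong false _   = refl

if-mono-≤ : ∀ b {x y : ℕ} → (T b → x ≤ y) → (if b then x else 0) ≤ (if b then y else 0)
if-mono-≤ true  x≤y = x≤y _
if-mono-≤ false _   = z≤n

if-cancel : ∀ b {x y : ℕ} → T b → (if b then x else 0) ≡ (if b then y else 0) → x ≡ y
if-cancel true _ x≡y = x≡y

if-distribˡ-* : ∀ b c {x} → (if b then c * x else 0) ≡ c * (if b then x else 0)
if-distribˡ-* true  c = refl
if-distribˡ-* false c = sym (*-zeroʳ c)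

count : ∀ {N} → (Fin N → Bool) → ℕ
count {N} p = ∑[ u < N ] (if p u then 1 else 0)

count-true : ∀ {N} → count {N} (const true) ≡ N
count-true {zero}  = refl
count-true {suc N} = cong suc count-true

∑-if-const : ∀ {N} (p : Fin N → Bool) c → ∑[ u < N ] (if p u then c else 0) ≡ c * count p
∑-if-const p c = begin
  ∑[ u < _ ] (if p u then c else 0)      ≡⟨ sum-cong-≗ (λ u → if-cong (p u) λ _ → *-identityʳ c) ⟨
  ∑[ u < _ ] (if p u then c * 1 else 0)  ≡⟨ sum-cong-≗ (λ u → if-distribˡ-* (p u) c) ⟩
  ∑[ u < _ ] (c * (if p u then 1 else 0)) ≡⟨ *-distribˡ-sum c (λ u → if p u then 1 else 0) ⟨
  c * count p                             ∎
  where open ≡-Reasoning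

length-filter≡count : ∀ {A : Set} {P : A → Set} (P? : ∀ x → Dec (P x)) xs →
                      length (filter P? xs) ≡ List.sum (map (λ x → if ⌊ P? x ⌋ then 1 else 0) xs)
length-filter≡count P? []       = refl
length-filter≡count P? (x ∷ xs) with P? x
... | yes _ = cong suc (length-filter≡count P? xs)
... | no  _ = length-filter≡count P? xs

∑∑ : ∀ {N} → (Fin N → Fin N → ℕ) → ℕ
∑∑ {N} F = ∑[ u < N ] ∑[ v < N ] F u v

∑∑-cong : ∀ {N} {F H : Fin N → Fin N → ℕ} → (∀ u v → F u v ≡ H u v) → ∑∑ F ≡ ∑∑ H
∑∑-cong F≡H = sum-cong-≗ (λ u → sum-cong-≗ (F≡H u))

∑∑-mono-≤ : ∀ {N} {F H : Fin N → Fin N → ℕ} → (∀ u v → F u v ≤ H u v) → ∑∑ F ≤ ∑∑ H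
∑∑-mono-≤ F≤H = ∑-mono-≤ (λ u → ∑-mono-≤ (F≤H u))

∑∑≡∑∑⇒≗ : ∀ {N} {F H : Fin N → Fin N → ℕ} → (∀ u v → F u v ≤ H u v) →
          ∑∑ F ≡ ∑∑ H → ∀ u v → F u v ≡ H u v
∑∑≡∑∑⇒≗ F≤H eq u = ∑≡∑⇒≗ (F≤H u) (∑≡∑⇒≗ (λ u → ∑-mono-≤ (F≤H u)) eq u)

∑∑-distrib-+ : ∀ {N} (F H : Fin N → Fin N → ℕ) → ∑∑ (λ u v → F u v + H u v) ≡ ∑∑ F + ∑∑ H
∑∑-distrib-+ {N} F H = trans (sum-cong-≗ (λ u → ∑-distrib-+ (F u) (H u)))
                              (∑-distrib-+ (λ u → ∑[ v < N ] F u v) (λ u → ∑[ v < N ] H u v))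

∑∑-distribˡ-* : ∀ {N} c (F : Fin N → Fin N → ℕ) → ∑∑ (λ u v → c * F u v) ≡ c * ∑∑ F
∑∑-distribˡ-* {N} c F = sym (trans (*-distribˡ-sum c (λ u → ∑[ v < N ] F u v))
                                   (sum-cong-≗ (λ u → *-distribˡ-sum c (F u))))

-- Sums over unordered pairs

-- ⌊_⌋ is isYes, which is stuck on open numbers, so this does not hold by refl.
<?-suc : ∀ m n → ⌊ suc m <? suc n ⌋ ≡ ⌊ m <? n ⌋
<?-suc m n = trans (isYes≗does (suc m <? suc n)) (sym (isYes≗does (m <? n)))

pairOf : ∀ {N} → (Fin N → Bool) → Fin N → Fin N → Bool
pairOf p u v = ⌊ toℕ u <? toℕ v ⌋ ∧ p u ∧ p v

pairSum : ∀ {N} → (Fin N → Bool) → (Fin N → Fin N → ℕ) → ℕ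
pairSum p w = ∑∑ (λ u v → if pairOf p u v then w u v else 0)

pairOf⁻ : ∀ {N} (p : Fin N → Bool) {u v} → T (pairOf p u v) → toℕ u < toℕ v × T (p u) × T (p v)
pairOf⁻ p {u} {v} uv with toℕ u <? toℕ v | p u | p v
... | yes u<v | true | true = u<v , _ , _

pairOf⁺ : ∀ {N} (p : Fin N → Bool) {u v} → toℕ u < toℕ v → T (p u) → T (p v) → T (pairOf p u v)
pairOf⁺ p {u} {v} u<v pu pv with toℕ u <? toℕ v | p u | p v
... | yes _  | true | true = _
... | no u≮v | _    | _    = u≮v u<v

pairOf⇒≢ : ∀ {N} (p : Fin N → Bool) {u v} → T (pairOf p u v) → u ≢ v
pairOf⇒≢ p uv = <⇒≢ (proj₁ (pairOf⁻ p uv)) ∘ cong toℕ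

pairSum-cong : ∀ {N} {p q : Fin N → Bool} {w w′ : Fin N → Fin N → ℕ} → (∀ u → p u ≡ q u) →
               (∀ u v → T (pairOf q u v) → w u v ≡ w′ u v) → pairSum p w ≡ pairSum q w′
pairSum-cong {p = p} {q} {w} p≡q w≡w′ = ∑∑-cong λ u v → trans
  (cong (λ b → if b then w u v else 0) (cong₂ (λ a b → ⌊ toℕ u <? toℕ v ⌋ ∧ a ∧ b) (p≡q u) (p≡q v)))
  (if-cong (pairOf q u v) (w≡w′ u v))

pairSum-mono-≤ : ∀ {N} (p : Fin N → Bool) {w w′ : Fin N → Fin N → ℕ} →
                 (∀ u v → T (pairOf p u v) → w u v ≤ w′ u v) → pairSum p w ≤ pairSum p w′
pairSum-mono-≤ p w≤w′ = ∑∑-mono-≤ λ u v → if-mono-≤ (pairOf p u v) (w≤w′ u v)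

pairSum≡pairSum⇒≡ : ∀ {N} (p : Fin N → Bool) {w w′ : Fin N → Fin N → ℕ} →
                    (∀ u v → T (pairOf p u v) → w u v ≤ w′ u v) → pairSum p w ≡ pairSum p w′ →
                    ∀ u v → T (pairOf p u v) → w u v ≡ w′ u v
pairSum≡pairSum⇒≡ p w≤w′ eq u v uv =
  if-cancel (pairOf p u v) uv (∑∑≡∑∑⇒≗ (λ u v → if-mono-≤ (pairOf p u v) (w≤w′ u v)) eq u v)

pairSum-distribˡ-* : ∀ {N} (p : Fin N → Bool) c (w : Fin N → Fin N → ℕ) →
                     pairSum p (λ u v → c * w u v) ≡ c * pairSum p w
pairSum-distribˡ-* p c w = trans (∑∑-cong λ u v → if-distribˡ-* (pairOf p u v) c)
                                 (∑∑-distribˡ-* c (λ u v → if pairOf p u v then w u v else 0))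

-- The terms at (zero, zero) and (suc u, zero) vanish by computation.
pairSum-suc : ∀ {N} (p : Fin (suc N) → Bool) (w : Fin (suc N) → Fin (suc N) → ℕ) →
              pairSum p w ≡ ∑[ v < N ] (if p zero ∧ p (suc v) then w zero (suc v) else 0)
                            + pairSum (p ∘ suc) (λ u v → w (suc u) (suc v))
pairSum-suc {N} p w =
  cong (∑[ v < N ] (if p zero ∧ p (suc v) then w zero (suc v) else 0) +_) (∑∑-cong λ u v →
    cong (λ b → if b ∧ p (suc u) ∧ p (suc v) then w (suc u) (suc v) else 0) (<?-suc (toℕ u) (toℕ v)))

pairSum-const : ∀ {N} (p : Fin N → Bool) c → pairSum p (λ _ _ → c) ≡ c * (count p C 2)
pairSum-const {zero}  p c = sym (*-zeroʳ c)
pairSum-const {suc N} p c = trans (pairSum-suc p (λ _ _ → c)) (first-row (p zero))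
  where
  k = count (p ∘ suc)
  first-row : ∀ b → ∑[ v < N ] (if b ∧ p (suc v) then c else 0) + pairSum (p ∘ suc) (λ _ _ → c)
                    ≡ c * (((if b then 1 else 0) + k) C 2)
  first-row true = begin
      ∑[ v < N ] (if p (suc v) then c else 0) + pairSum (p ∘ suc) (λ _ _ → c)
    ≡⟨ cong₂ _+_ (∑-if-const (p ∘ suc) c) (pairSum-const (p ∘ suc) c) ⟩
      c * k + c * (k C 2)
    ≡⟨ *-distribˡ-+ c k (k C 2) ⟨
      c * (k + k C 2)
    ≡⟨ cong (c *_) (suc-C-2 k) ⟨
      c * (suc k C 2)
    ∎
    where open ≡-Reasoning
  first-row false = cong₂ _+_ (sum-replicate-zero N) (pairSum-const (p ∘ suc) c)

pairSum-1 : ∀ {N} (p : Fin N → Bool) → pairSum p (λ _ _ → 1) ≡ count p C 2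
pairSum-1 p = trans (pairSum-const p 1) (*-identityˡ _)

-- Walks and distances

least-cong : ∀ {p q : ℕ → Bool} → (∀ i → p i ≡ q i) → ∀ f k → least p f k ≡ least q f k
least-cong         p≡q zero    k = refl
least-cong {q = q} p≡q (suc f) k rewrite p≡q k =
  cong (λ l → if q k then k else l) (least-cong p≡q f (suc k))

least-≤ : ∀ p f {k j} → T (p j) → k ≤ j → least p f k ≤ j
least-≤ p zero        pj k≤j = k≤j
least-≤ p (suc f) {k} pj k≤j with p k in pk
... | true  = k≤j
... | false = least-≤ p f pj (≤∧≢⇒< k≤j λ { refl → subst T pk pj })

least-≥ : ∀ p f k {j} → (∀ {i} → k ≤ i → i < j → ¬ T (p i)) → j ≤ k + f → j ≤ least p f k
least-≥ p zero    k     _ j≤k+0 = subst (_ ≤_) (+-identityʳ k) j≤k+0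
least-≥ p (suc f) k {j} h j≤k+1+f with p k in pk
... | true  = ≮⇒≥ λ k<j → h ≤-refl k<j (subst T (sym pk) _)
... | false = least-≥ p f (suc k) (λ k<i → h (<⇒≤ k<i)) (subst (j ≤_) (+-suc k f) j≤k+1+f)

distinct⇒2≤ : ∀ {N} {u v : Fin N} → u ≢ v → 2 ≤ N
distinct⇒2≤ {suc zero}    {zero} {zero} u≢v = contradiction refl u≢v
distinct⇒2≤ {suc (suc N)} _ = s≤s (s≤s z≤n)

module _ {N} (G : Graph N) where

  reach-refl : ∀ {u} → T (reach G 0 u u)
  reach-refl = fromWitness refl

  reach-weaken : ∀ {k u v} → T (reach G k u v) → T (reach G (suc k) u v)
  reach-weaken r = Equivalence.from T-∨ (inj₁ r)

  reach-extend : ∀ {k u w v} → T (reach G k u w) → T (G w v) → T (reach G (suc k) u v)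
  reach-extend {k} {u} {w} {v} r e =
    Equivalence.from T-∨ (inj₂ (any⁺ step (tabulate⁺ w (Equivalence.from T-∧ (r , e)))))
    where
    step : Fin N → Bool
    step x = reach G k u x ∧ G x v

  reach-suc⁻ : ∀ {k u v} → T (reach G (suc k) u v) →
               T (reach G k u v) ⊎ ∃[ w ] T (reach G k u w) × T (G w v)
  reach-suc⁻ {k} {u} {v} r with Equivalence.to T-∨ r
  ... | inj₁ r′ = inj₁ r′
  ... | inj₂ r′ with tabulate⁻ (any⁻ (λ x → reach G k u x ∧ G x v) (allFin N) r′)
  ...   | w , rw = inj₂ (w , Equivalence.to T-∧ rw)

  reach-1⁻ : ∀ {u v} → T (reach G 1 u v) → u ≡ v ⊎ T (G u v)
  reach-1⁻ {u} {v} r with reach-suc⁻ {0} {u} {v} r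
  ... | inj₁ r₀ = inj₁ (toWitness {a? = u ≟ v} r₀)
  ... | inj₂ (w , r₀ , e) with refl ← toWitness {a? = u ≟ w} r₀ = inj₂ e

  reach-prepend : ∀ {k u w v} → T (G u w) → T (reach G k w v) → T (reach G (suc k) u v)
  reach-prepend {zero} {u} {w} {v} e r with refl ← toWitness {a? = w ≟ v} r =
    reach-extend {0} (reach-refl {u}) e
  reach-prepend {suc k} {u} {w} {v} e r with reach-suc⁻ {k} {w} {v} r
  ... | inj₁ r′ = reach-weaken {suc k} {u} {v} (reach-prepend {k} e r′)
  ... | inj₂ (x , r′ , e′) = reach-extend {suc k} {u} {x} {v} (reach-prepend {k} e r′) e′

  reach-sym : IsSimple G → ∀ {k u v} → T (reach G k u v) → T (reach G k v u)
  reach-sym S {zero}  {u} {v} r = fromWitness (sym (toWitness {a? = u ≟ v} r))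
  reach-sym S {suc k} {u} {v} r with reach-suc⁻ {k} {u} {v} r
  ... | inj₁ r′ = reach-weaken {k} {v} {u} (reach-sym S {k} r′)
  ... | inj₂ (w , r′ , e) =
    reach-prepend {k} {v} {w} {u} (subst T (proj₁ S w v) e) (reach-sym S {k} r′)

  dist-≤ : ∀ {k u v} → T (reach G k u v) → dist G u v ≤ k
  dist-≤ r = least-≤ _ N r z≤n

  dist-≥ : ∀ {j u v} → j ≤ N → (∀ {i} → i < j → ¬ T (reach G i u v)) → j ≤ dist G u v
  dist-≥ j≤N h = least-≥ _ N 0 (λ _ → h) j≤N

  dist-sym : IsSimple G → ∀ u v → dist G u v ≡ dist G v u
  dist-sym S u v = least-cong (λ k → ⇔→≡ {z = true} (mk⇔ (sym-≡ u v {k}) (sym-≡ v u {k}))) N 0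
    where
    sym-≡ : ∀ u v {k} → reach G k u v ≡ true → reach G k v u ≡ true
    sym-≡ u v {k} = Equivalence.to T-≡ ∘ reach-sym S {k} {u} {v} ∘ Equivalence.from T-≡

  dist-self : ∀ u → dist G u u ≡ 0
  dist-self u = n≤0⇒n≡0 (dist-≤ {0} (reach-refl {u}))

  1≤dist : ∀ {u v} → u ≢ v → 1 ≤ dist G u v
  1≤dist {u} {v} u≢v =
    dist-≥ (≤-trans (s≤s z≤n) (toℕ<n u)) λ { (s≤s z≤n) r → u≢v (toWitness {a? = u ≟ v} r) }

  2≤dist : ∀ {u v} → u ≢ v → ¬ T (G u v) → 2 ≤ dist G u v
  2≤dist {u} {v} u≢v ¬e = dist-≥ (distinct⇒2≤ u≢v) λ
    { (s≤s z≤n)       r → u≢v (toWitness {a? = u ≟ v} r)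
    ; (s≤s (s≤s z≤n)) r → [ u≢v , ¬e ]′ (reach-1⁻ r) }

  dist-adjacent : ∀ {u v} → u ≢ v → T (G u v) → dist G u v ≡ 1
  dist-adjacent {u} {v} u≢v e =
    ≤-antisym (dist-≤ {1} (reach-extend {0} (reach-refl {u}) e)) (1≤dist u≢v)

  dist-two : ∀ {u w v} → u ≢ v → ¬ T (G u v) → T (G u w) → T (G w v) → dist G u v ≡ 2
  dist-two {u} {w} {v} u≢v ¬e e₁ e₂ =
    ≤-antisym (dist-≤ {2} (reach-extend {1} (reach-extend {0} (reach-refl {u}) e₁) e₂)) (2≤dist u≢v ¬e)

  dist≤1⇒adjacent : ∀ {u v} → u ≢ v → dist G u v ≤ 1 → T (G u v)
  dist≤1⇒adjacent {u} {v} u≢v d≤1 with T? (G u v)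
  ... | yes e  = e
  ... | no  ¬e = contradiction (≤-trans (2≤dist u≢v ¬e) d≤1) λ { (s≤s ()) }

-- Eccentricity and peripheral vertices

maxOver : ∀ {N} → (Fin N → ℕ) → ℕ
maxOver {N} f = maxList (map f (allFin N))

≤-maxList : ∀ {x xs} → x ∈ xs → x ≤ maxList xs
≤-maxList (here refl)  = m≤m⊔n _ _
≤-maxList (there x∈xs) = ≤-trans (≤-maxList x∈xs) (m≤n⊔m _ _)

maxList-≤ : ∀ {c} xs → (∀ {x} → x ∈ xs → x ≤ c) → maxList xs ≤ c
maxList-≤ []       _ = z≤n
maxList-≤ (x ∷ xs) h = ⊔-lub (h (here refl)) (maxList-≤ xs (h ∘ there))

module _ {N} (f : Fin N → ℕ) where

  ≤-maxOver : ∀ i → f i ≤ maxOver f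
  ≤-maxOver i = ≤-maxList (∈-map⁺ f (∈-allFin i))

  maxOver-≤ : ∀ {c} → (∀ i → f i ≤ c) → maxOver f ≤ c
  maxOver-≤ {c} h = maxList-≤ _ λ x∈ → bound (∈-map⁻ f x∈)
    where
    bound : ∀ {x} → ∃[ i ] i ∈ allFin N × x ≡ f i → x ≤ c
    bound (i , _ , refl) = h i

  maxOver-≡ : ∀ {c j} → (∀ i → f i ≤ c) → f j ≡ c → maxOver f ≡ c
  maxOver-≡ {j = j} h fj≡c = ≤-antisym (maxOver-≤ h) (subst (_≤ maxOver f) fj≡c (≤-maxOver j))

  maxOver-attained : Fin N → ∃[ j ] maxOver f ≡ f j
  maxOver-attained i with foldr-selective ⊔-sel 0 (map f (allFin N))
  ... | inj₁ max≡0 = i , ≤-antisym (≤-trans (≤-reflexive max≡0) z≤n) (≤-maxOver i)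
  ... | inj₂ max∈  with ∈-map⁻ f max∈
  ...   | j , _ , max≡fj = j , max≡fj

module _ {N} (G : Graph N) where

  dist≤ecc : ∀ u v → dist G u v ≤ ecc G v
  dist≤ecc u v = ≤-maxOver (λ x → dist G x v) u

  ecc≤diam : ∀ v → ecc G v ≤ diam G
  ecc≤diam = ≤-maxOver (ecc G)

  isPeri-true : ∀ {v} → ecc G v ≡ diam G → isPeri G v ≡ true
  isPeri-true {v} e = trans (isYes≗does (ecc G v ≟ℕ diam G)) (dec-true (ecc G v ≟ℕ diam G) e)

  isPeri-false : ∀ {v} → ecc G v ≢ diam G → isPeri G v ≡ false
  isPeri-false {v} e = trans (isYes≗does (ecc G v ≟ℕ diam G)) (dec-false (ecc G v ≟ℕ diam G) e)

  isPeri-const-ecc : ∀ {e} → (∀ v → ecc G v ≡ e) → ∀ v → isPeri G v ≡ true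
  isPeri-const-ecc ecc≡e v =
    isPeri-true (trans (ecc≡e v) (sym (maxOver-≡ (ecc G) (≤-reflexive ∘ ecc≡e) (ecc≡e v))))

  numPeri≡count : numPeri G ≡ count (isPeri G)
  numPeri≡count = trans (length-filter≡count (λ v → ecc G v ≟ℕ diam G) (allFin N))
                        (sum-map-allFin (λ v → if isPeri G v then 1 else 0))

pairWeight : ∀ {N} → Graph N → Fin N → Fin N → ℕ
pairWeight G u v = suc (dist G u v) C 2

PWW≡pairSum : ∀ {N} (G : Graph N) → PWW G ≡ pairSum (isPeri G) (pairWeight G)
PWW≡pairSum {N} G = begin
    PWW G
  ≡⟨ cong (_/ 2) (trans (sum-map-allFin (λ u → List.sum (map (term u) (allFin N))))
                         (sum-cong-≗ λ u → sum-map-allFin (term u))) ⟩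
    pairSum p (λ u v → d u v + d u v * d u v) / 2
  ≡⟨ cong (_/ 2) (pairSum-cong {q = p} (λ _ → refl) λ u v _ → n+n*n≡2*[1+n]C2 (d u v)) ⟩
    pairSum p (λ u v → 2 * pairWeight G u v) / 2
  ≡⟨ cong (_/ 2) (trans (pairSum-distribˡ-* p 2 (pairWeight G))
                         (*-comm 2 (pairSum p (pairWeight G)))) ⟩
    pairSum p (pairWeight G) * 2 / 2
  ≡⟨ m*n/n≡m (pairSum p (pairWeight G)) 2 ⟩
    pairSum p (pairWeight G)
  ∎
  where
  open ≡-Reasoning
  p = isPeri G
  d = dist G
  term : Fin N → Fin N → ℕ
  term u v = if pairOf p u v then d u v + d u v * d u v else 0

-- Complete graphs

IsComplete : ∀ {N} → Graph N → Set
IsComplete {N} G = ∀ u v → G u v ≡ K N u v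

other-vertex : ∀ {N} → 2 ≤ N → (v : Fin N) → ∃[ w ] w ≢ v
other-vertex (s≤s (s≤s _)) zero    = suc zero , λ ()
other-vertex (s≤s (s≤s _)) (suc v) = zero , λ ()

complete⇒≅K : ∀ {N} {G : Graph N} → IsComplete G → G ≅ K N
complete⇒≅K complete = ↔-id _ , complete

≅K⇒complete : ∀ {N r} {G : Graph N} → G ≅ K r → IsComplete G
≅K⇒complete (f , G≡K) u v = trans (G≡K u v) (cong not (begin
    ⌊ to u ≟ to v ⌋    ≡⟨ isYes≗does (to u ≟ to v) ⟩
    does (to u ≟ to v) ≡⟨ does-⇔ (mk⇔ (Injection.injective (↔⇒↣ f)) (cong to)) (to u ≟ to v) (u ≟ v) ⟩
    does (u ≟ v)       ≡⟨ isYes≗does (u ≟ v) ⟨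
    ⌊ u ≟ v ⌋          ∎))
  where
  open ≡-Reasoning
  open Inverse f using (to)

module _ {N} {G : Graph N} (complete : IsComplete G) (2≤N : 2 ≤ N) where

  complete-dist : ∀ {u v} → u ≢ v → dist G u v ≡ 1
  complete-dist {u} {v} u≢v =
    dist-adjacent G u≢v (subst T (sym (complete u v)) (fromWitnessFalse u≢v))

  complete-isPeri : ∀ v → isPeri G v ≡ true
  complete-isPeri = isPeri-const-ecc G ecc≡1
    where
    ecc≡1 : ∀ v → ecc G v ≡ 1
    ecc≡1 v = maxOver-≡ (λ u → dist G u v) dist≤1 (complete-dist (proj₂ (other-vertex 2≤N v)))
      where
      dist≤1 : ∀ u → dist G u v ≤ 1
      dist≤1 u with u ≟ v
      ... | yes refl = ≤-trans (≤-reflexive (dist-self G u)) z≤n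
      ... | no  u≢v  = ≤-reflexive (complete-dist u≢v)

  numPeri-complete : numPeri G ≡ N
  numPeri-complete = begin
    numPeri G            ≡⟨ numPeri≡count G ⟩
    count (isPeri G)     ≡⟨ sum-cong-≗ (λ v → cong (λ b → if b then 1 else 0) (complete-isPeri v)) ⟩
    count {N} (const true) ≡⟨ count-true ⟩
    N                    ∎
    where open ≡-Reasoning

  PWW-complete : PWW G ≡ N C 2
  PWW-complete = begin
    PWW G                                ≡⟨ PWW≡pairSum G ⟩
    pairSum (isPeri G) (pairWeight G)    ≡⟨ pairSum-cong complete-isPeri weight≡1 ⟩
    pairSum all (λ _ _ → 1)              ≡⟨ pairSum-1 all ⟩
    count all C 2                        ≡⟨ cong (_C 2) (count-true {N}) ⟩
    N C 2                                ∎
    where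
    open ≡-Reasoning
    all : Fin N → Bool
    all = const true
    weight≡1 : ∀ u v → T (pairOf all u v) → pairWeight G u v ≡ 1
    weight≡1 u v uv = cong (λ d → suc d C 2) (complete-dist (pairOf⇒≢ all uv))

-- The lower bound and its equality case

module _ {N} (G : Graph N) where

  private
    pairSum-1≡numPeriC2 : pairSum (isPeri G) (λ _ _ → 1) ≡ numPeri G C 2
    pairSum-1≡numPeriC2 = trans (pairSum-1 (isPeri G)) (cong (_C 2) (sym (numPeri≡count G)))

    1≤weight : ∀ u v → T (pairOf (isPeri G) u v) → 1 ≤ pairWeight G u v
    1≤weight u v uv = ≤-trans (1≤dist G (pairOf⇒≢ (isPeri G) uv)) (n≤[1+n]C2 (dist G u v))

  numPeriC2≤PWW : numPeri G C 2 ≤ PWW G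
  numPeriC2≤PWW =
    subst₂ _≤_ pairSum-1≡numPeriC2 (sym (PWW≡pairSum G)) (pairSum-mono-≤ (isPeri G) 1≤weight)

  module _ (S : IsSimple G) (tight : PWW G ≡ numPeri G C 2) where

    private
      ordered-peripheral-dist≤1 : ∀ u v → T (pairOf (isPeri G) u v) → dist G u v ≤ 1
      ordered-peripheral-dist≤1 u v uv = subst (dist G u v ≤_) weight≡1 (n≤[1+n]C2 (dist G u v))
        where
        weight≡1 : pairWeight G u v ≡ 1
        weight≡1 = sym (pairSum≡pairSum⇒≡ (isPeri G) 1≤weight
          (trans pairSum-1≡numPeriC2 (trans (sym tight) (PWW≡pairSum G))) u v uv)

      peripheral-dist≤1 : ∀ {u v} → T (isPeri G u) → T (isPeri G v) → dist G u v ≤ 1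
      peripheral-dist≤1 {u} {v} pu pv with <-cmp (toℕ u) (toℕ v)
      ... | tri< u<v _ _ = ordered-peripheral-dist≤1 u v (pairOf⁺ (isPeri G) u<v pu pv)
      ... | tri≈ _ u≡v _ rewrite toℕ-injective u≡v = ≤-trans (≤-reflexive (dist-self G v)) z≤n
      ... | tri> _ _ v<u = subst (_≤ 1) (dist-sym G S v u)
                                 (ordered-peripheral-dist≤1 v u (pairOf⁺ (isPeri G) v<u pv pu))

      -- v has maximum eccentricity and u is farthest from v, so both are peripheral.
      all-dist≤1 : ∀ x y → dist G x y ≤ 1
      all-dist≤1 x y with maxOver-attained (ecc G) y
      ... | v , diam≡ecc-v with maxOver-attained (λ u → dist G u v) v
      ...   | u , ecc-v≡dist-uv = begin
        dist G x y ≤⟨ dist≤ecc G x y ⟩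
        ecc G y    ≤⟨ ecc≤diam G y ⟩
        diam G     ≡⟨ trans diam≡ecc-v ecc-v≡dist-uv ⟩
        dist G u v ≤⟨ peripheral-dist≤1 (fromWitness u-peripheral) (fromWitness (sym diam≡ecc-v)) ⟩
        1          ∎
        where
        open ≤-Reasoning
        u-peripheral : ecc G u ≡ diam G
        u-peripheral = ≤-antisym (ecc≤diam G u) (begin
          diam G     ≡⟨ trans diam≡ecc-v ecc-v≡dist-uv ⟩
          dist G u v ≡⟨ dist-sym G S u v ⟩
          dist G v u ≤⟨ dist≤ecc G v u ⟩
          ecc G u    ∎)

    PWW≡numPeriC2⇒complete : IsComplete G
    PWW≡numPeriC2⇒complete u v with u ≟ v
    ... | yes refl = proj₂ S u
    ... | no  u≢v  = Equivalence.to T-≡ (dist≤1⇒adjacent G u≢v (all-dist≤1 u v))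

PWW≡numPeriC2⇔≅K : ∀ {N} (G : Graph N) → 2 ≤ N → IsSimple G →
                   PWW G ≡ numPeri G C 2 ⇔ G ≅ K (numPeri G)
PWW≡numPeriC2⇔≅K G 2≤N S = mk⇔
  (λ tight → let complete = PWW≡numPeriC2⇒complete G S tight in
             subst (λ r → G ≅ K r) (sym (numPeri-complete complete 2≤N)) (complete⇒≅K complete))
  (λ iso → let complete = ≅K⇒complete iso in
           trans (PWW-complete complete 2≤N) (cong (_C 2) (sym (numPeri-complete complete 2≤N))))

-- Complete bipartite graphs

-- KB m n u v is definitionally left m u xor left m v.
left : ∀ {N} → ℕ → Fin N → Bool
left m u = ⌊ toℕ u <? m ⌋

left-↑ʳ : ∀ m {n} (j : Fin n) → left m (m ↑ʳ j) ≡ false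
left-↑ʳ zero    j = refl
left-↑ʳ (suc m) j = trans (<?-suc (toℕ (m ↑ʳ j)) m) (left-↑ʳ m j)

count-left : ∀ m n → count {m + n} (left m) ≡ m
count-left zero    n = sum-replicate-zero n
count-left (suc m) n = cong suc (trans
  (sum-cong-≗ {m + n} λ u → cong (λ b → if b then 1 else 0) (<?-suc (toℕ u) m)) (count-left m n))

count-right : ∀ m n → count {m + n} (not ∘ left m) ≡ n
count-right zero    n = count-true
count-right (suc m) n = trans
  (sum-cong-≗ {m + n} λ u → cong (λ b → if not b then 1 else 0) (<?-suc (toℕ u) m)) (count-right m n)

fibre-partner : ∀ {N} {A : Set} (f : Fin N → A) {x y} → x ≢ y → f x ≡ f y →
                ∀ v → f x ≡ f v → ∃[ w ] w ≢ v × f w ≡ f v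
fibre-partner f {x} {y} x≢y fx≡fy v fx≡fv with x ≟ v
... | yes refl = y , x≢y ∘ sym , sym fx≡fy
... | no  x≢v  = x , x≢v , fx≡fv

module _ {m n : ℕ} where

  private
    G = KB m n

  -- Two vertices in the same part have the first vertex of the other part as common neighbour.
  KB-dist : 1 ≤ m → 1 ≤ n → ∀ {u v} → u ≢ v →
            dist G u v ≡ (if left m u xor left m v then 1 else 2)
  KB-dist (s≤s z≤n) (s≤s z≤n) {u} {v} u≢v with left m u in lu | left m v in lv
  ... | true  | false = dist-adjacent G u≢v (subst T (sym (cong₂ _xor_ lu lv)) _)
  ... | false | true  = dist-adjacent G u≢v (subst T (sym (cong₂ _xor_ lu lv)) _)
  ... | true  | true  = dist-two G u≢v (subst T (cong₂ _xor_ lu lv))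
                          (subst T (sym (cong₂ _xor_ lu (left-↑ʳ m zero))) _)
                          (subst T (sym (cong₂ _xor_ (left-↑ʳ m zero) lv)) _)
  ... | false | false = dist-two G {w = zero} u≢v (subst T (cong₂ _xor_ lu lv))
                          (subst T (sym (cong₂ _xor_ lu refl)) _)
                          (subst T (sym (cong₂ _xor_ refl lv)) _)

  KB-dist≤2 : 1 ≤ m → 1 ≤ n → ∀ u v → dist G u v ≤ 2
  KB-dist≤2 1≤m 1≤n u v with u ≟ v
  ... | yes refl = ≤-trans (≤-reflexive (dist-self G u)) z≤n
  ... | no  u≢v  = ≤-trans (≤-reflexive (KB-dist 1≤m 1≤n u≢v)) (if-1-2≤2 (left m u xor left m v))
    where
    if-1-2≤2 : ∀ b → (if b then 1 else 2) ≤ 2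
    if-1-2≤2 true  = s≤s z≤n
    if-1-2≤2 false = ≤-refl

  KB-ecc≤2 : 1 ≤ m → 1 ≤ n → ∀ v → ecc G v ≤ 2
  KB-ecc≤2 1≤m 1≤n v = maxOver-≤ (λ u → dist G u v) (λ u → KB-dist≤2 1≤m 1≤n u v)

  KB-ecc≡2 : 1 ≤ m → 1 ≤ n → ∀ {v w} → w ≢ v → left m w ≡ left m v → ecc G v ≡ 2
  KB-ecc≡2 1≤m 1≤n {v} w≢v same = maxOver-≡ (λ u → dist G u v) (λ u → KB-dist≤2 1≤m 1≤n u v)
    (trans (KB-dist 1≤m 1≤n w≢v)
           (cong (λ b → if b then 1 else 2) (trans (cong (_xor left m v) same) (xor-same (left m v)))))

  KB-same-side-partner : 2 ≤ m → 2 ≤ n → ∀ (v : Fin (m + n)) →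
                         ∃[ w ] w ≢ v × left m w ≡ left m v
  KB-same-side-partner (s≤s (s≤s z≤n)) (s≤s (s≤s z≤n)) v = on-side (left m v) refl
    where
    right₀≢right₁ : m ↑ʳ zero ≢ m ↑ʳ suc zero
    right₀≢right₁ eq = contradiction (↑ʳ-injective m zero (suc zero) eq) λ ()
    on-side : ∀ b → left m v ≡ b → ∃[ w ] w ≢ v × left m w ≡ left m v
    on-side true  lv = fibre-partner (left {m + n} m) {zero} {suc zero} (λ ()) refl v (sym lv)
    on-side false lv = fibre-partner (left {m + n} m) right₀≢right₁
      (trans (left-↑ʳ m zero) (sym (left-↑ʳ m (suc zero)))) v (trans (left-↑ʳ m zero) (sym lv))

  KB-weight-split : 1 ≤ m → 1 ≤ n → ∀ u v →
    (if pairOf (const true) u v then pairWeight G u v else 0)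
      ≡ (if pairOf (const true) u v then 1 else 0)
        + 2 * ((if pairOf (left m) u v then 1 else 0) + (if pairOf (not ∘ left m) u v then 1 else 0))
  KB-weight-split 1≤m 1≤n u v with toℕ u <? toℕ v
  ... | no  _   = refl
  ... | yes u<v rewrite KB-dist 1≤m 1≤n (<⇒≢ u<v ∘ cong toℕ) with left m u | left m v
  ...   | true  | true  = refl
  ...   | true  | false = refl
  ...   | false | true  = refl
  ...   | false | false = refl

  PWW-KB : 2 ≤ m → 2 ≤ n → PWW G ≡ 3 * (n C 2) + 3 * (m C 2) + n * m
  PWW-KB 2≤m 2≤n = begin
      PWW G
    ≡⟨ PWW≡pairSum G ⟩
      pairSum (isPeri G) (pairWeight G)
    ≡⟨ pairSum-cong {q = all} (isPeri-const-ecc G ecc≡2) (λ _ _ _ → refl) ⟩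
      pairSum all (pairWeight G)
    ≡⟨ ∑∑-cong (KB-weight-split 1≤m 1≤n) ⟩
      ∑∑ (λ u v → ind all u v + 2 * (ind L u v + ind R u v))
    ≡⟨ ∑∑-distrib-+ (ind all) (λ u v → 2 * (ind L u v + ind R u v)) ⟩
      pairs all + ∑∑ (λ u v → 2 * (ind L u v + ind R u v))
    ≡⟨ cong (pairs all +_) (trans (∑∑-distribˡ-* 2 (λ u v → ind L u v + ind R u v))
                                  (cong (2 *_) (∑∑-distrib-+ (ind L) (ind R)))) ⟩
      pairs all + 2 * (pairs L + pairs R)
    ≡⟨ cong₂ (λ a b → a + 2 * b) (pairSum-1 all) (cong₂ _+_ (pairSum-1 L) (pairSum-1 R)) ⟩
      count all C 2 + 2 * (count L C 2 + count R C 2)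
    ≡⟨ cong₂ (λ a b → a C 2 + 2 * b) (count-true {m + n})
             (cong₂ (λ a b → a C 2 + b C 2) (count-left m n) (count-right m n)) ⟩
      (m + n) C 2 + 2 * (m C 2 + n C 2)
    ≡⟨ cong (_+ 2 * (m C 2 + n C 2)) (+-C-2 m n) ⟩
      m C 2 + n C 2 + m * n + 2 * (m C 2 + n C 2)
    ≡⟨ regroup (m C 2) (n C 2) m n ⟩
      3 * (n C 2) + 3 * (m C 2) + n * m
    ∎
    where
    open ≡-Reasoning
    1≤m = ≤-trans (s≤s z≤n) 2≤m
    1≤n = ≤-trans (s≤s z≤n) 2≤n
    all L R : Fin (m + n) → Bool
    all = const true
    L   = left m
    R   = not ∘ left m
    ind : (Fin (m + n) → Bool) → Fin (m + n) → Fin (m + n) → ℕ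
    ind p u v = if pairOf p u v then 1 else 0
    pairs : (Fin (m + n) → Bool) → ℕ
    pairs p = pairSum p (λ _ _ → 1)
    ecc≡2 : ∀ v → ecc G v ≡ 2
    ecc≡2 v with KB-same-side-partner 2≤m 2≤n v
    ... | w , w≢v , same = KB-ecc≡2 1≤m 1≤n w≢v same
    regroup : ∀ a b m n → a + b + m * n + 2 * (a + b) ≡ 3 * b + 3 * a + n * m
    regroup = solve-∀

PWW-star : ∀ n → 2 ≤ n → PWW (KB 1 n) ≡ 3 * (n C 2)
PWW-star n (s≤s (s≤s z≤n)) = begin
    PWW G                              ≡⟨ PWW≡pairSum G ⟩
    pairSum (isPeri G) (pairWeight G)  ≡⟨ pairSum-cong peripheral leaf-weight ⟩
    pairSum leaf (λ _ _ → 3)           ≡⟨ pairSum-const leaf 3 ⟩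
    3 * (count leaf C 2)               ≡⟨ cong (λ k → 3 * (k C 2)) (count-right 1 n) ⟩
    3 * (n C 2)                        ∎
  where
  open ≡-Reasoning
  G = KB 1 n
  leaf : Fin (1 + n) → Bool
  leaf = not ∘ left 1
  centre-ecc : ecc G zero ≡ 1
  centre-ecc = maxOver-≡ (λ u → dist G u zero) {j = suc zero} dist≤1
                 (KB-dist {1} {n} (s≤s z≤n) (s≤s z≤n) {suc zero} {zero} λ ())
    where
    dist≤1 : ∀ u → dist G u zero ≤ 1
    dist≤1 zero    = ≤-trans (≤-reflexive (dist-self G zero)) z≤n
    dist≤1 (suc j) = ≤-reflexive (KB-dist {1} {n} (s≤s z≤n) (s≤s z≤n) {suc j} {zero} λ ())
  leaf-ecc : ∀ j → ecc G (suc j) ≡ 2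
  leaf-ecc j with fibre-partner (left {1 + n} 1) {suc zero} {suc (suc zero)} (λ ()) refl
                                (suc j) refl
  ... | w , w≢v , same = KB-ecc≡2 {1} {n} (s≤s z≤n) (s≤s z≤n) {suc j} w≢v same
  diam≡2 : diam G ≡ 2
  diam≡2 = maxOver-≡ (ecc G) {j = suc zero} (KB-ecc≤2 {1} {n} (s≤s z≤n) (s≤s z≤n)) (leaf-ecc zero)
  peripheral : ∀ v → isPeri G v ≡ leaf v
  peripheral zero    = isPeri-false G {zero} λ e →
    contradiction (trans (sym centre-ecc) (trans e diam≡2)) λ ()
  peripheral (suc j) = isPeri-true G {suc j} (trans (leaf-ecc j) (sym diam≡2))
  leaf-weight : ∀ u v → T (pairOf leaf u v) → pairWeight G u v ≡ 3
  leaf-weight u v uv with pairOf⁻ leaf {u} {v} uv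
  ... | _ , lu , lv = cong (λ d → suc d C 2)
    (trans (KB-dist {1} {n} (s≤s z≤n) (s≤s z≤n) (pairOf⇒≢ leaf {u} {v} uv))
           (cong₂ (λ a b → if a xor b then 1 else 2)
                  (Equivalence.to T-not-≡ lu) (Equivalence.to T-not-≡ lv)))

mainTheorem1 : (m n : ℕ) → 2 ≤ m → m ≤ n →
    (PWW (K n) ≡ n C 2)
    × (PWW (KB 1 n) ≡ 3 * (n C 2))
    × (PWW (KB m n) ≡ 3 * (n C 2) + 3 * (m C 2) + n * m)
    × (∀ (N : ℕ) (G : Graph N) → 2 ≤ N → IsSimple G → IsConnected G →
         ∀ (r : ℕ) → numPeri G ≡ r →
         (r C 2 ≤ PWW G) × (PWW G ≡ r C 2 ⇔ G ≅ K r))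
mainTheorem1 m n 2≤m m≤n =
    PWW-complete {G = K n} (λ _ _ → refl) 2≤n
  , PWW-star n 2≤n
  , PWW-KB 2≤m 2≤n
  , λ { N G 2≤N simple _ r refl → numPeriC2≤PWW G , PWW≡numPeriC2⇔≅K G 2≤N simple }
  where
  2≤n = ≤-trans 2≤m m≤n
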